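{- Let $\mathcal{G}$ be a temporal graph with $n$ vertices and lifetime $[1,\tau]$. Every irredundant set of R-tuples of $\mathcal{G}$ has size $O(n^2\tau)$, and this bound is tight: for all $n,\tau$ there exist temporal graphs on $n$ vertices with lifetime $[1,\tau]$ admitting an irredundant set of R-tuples of size $\Theta(n^2\tau)$. Hence the maximum size of an irredundant set of R-tuples for $\mathcal{G}$ is $\Theta(n^2\tau)$.
   Context: A temporal graph $\mathcal{G}$ consists of a finite vertex set $V$ ($|V|=n$), arcs $E\subseteq V\times V$, lifetime $\mathcal{T}=[1,\tau]\subseteq\mathbb{N}$, a presence function $\rho:E\times\mathcal{T}\to\{0,1\}$, and a constant latency $\delta\in\mathbb{N}$. A contact is a triple $(u,v,t)$ with $\rho((u,v),t)=1$. A journey from $u$ to $v$ is a sequence of contacts $\langle (u_1,v_1,t_1),\dots,(u_k,v_k,t_k)\rangle$ forming a directed $u$–$v$ path with $t_{i+1}\ge t_i+\delta$; its departure is $t_1$ and arrival $t_k+\delta$. An R-tuple of $\mathcal{G}$ is a quadruple $(u,v,t^-,t^+)$ with $u,v\in V$ such that some journey from $u$ to $v$ in $\mathcal{G}$ has departure $t^-$ and arrival $t^+$. For R-tuples $r_1=(u_1,v_1,t_1^-,t_1^+)$, $r_2=(u_2,v_2,t_2^-,t_2^+)$, write $r_1\subseteq r_2$ if $u_1=u_2$, $v_1=v_2$ and $t_2^-\le t_1^-\le t_1^+\le t_2^+$. In a set $S$ of R-tuples, $r\in S$ is redundant if some other $r'\in S$ satisfies $r'\subseteq r$; $S$ is irredundant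 if it contains no redundant R-tuple. -}

module Defs where

open import Data.Nat using (ℕ; _≤_; _+_)
open import Data.Fin using (Fin)
open import Data.Bool using (Bool; true)
open import Data.Product using (_×_; ∃-syntax)
open import Data.List using (List)
open import Data.List.Membership.Propositional using (_∈_)
open import Data.List.Relation.Unary.All using (All)
open import Data.List.Relation.Unary.Unique.Propositional using (Unique)
open import Relation.Binary.PropositionalEquality using (_≡_; _≢_)
open import Relation.Nullary using (¬_)

-- A temporal graph with vertex set V = Fin n and lifetime [1, τ].
-- arc u v = true  iff  (u , v) ∈ E;
-- present u v t = ρ((u,v),t) (only relevant for arcs and t ∈ [1,τ]);
-- δ is the constant latency.
record TemporalGraph (n τ : ℕ) : Set where
  field
    arc     : Fin n → Fin n → Bool
    present : Fin n → Fin n → ℕ → Bool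
    δ       : ℕ

module _ {n τ : ℕ} (G : TemporalGraph n τ) where
  open TemporalGraph G

  record Contact (u v : Fin n) (t : ℕ) : Set where
    constructor contact
    field
      isArc     : arc u v ≡ true
      inLife₁   : 1 ≤ t
      inLifeτ   : t ≤ τ
      isPresent : present u v t ≡ true

  -- Its arrival is l + δ.
  data Journey (u : Fin n) : Fin n → ℕ → ℕ → Set where
    single : ∀ {v t} → Contact u v t → Journey u v t t
    extend : ∀ {w v d t t'} → Journey u w d t → Contact w v t' →
             t + δ ≤ t' → Journey u v d t'

record RTuple (n : ℕ) : Set where
  constructor rtuple
  field
    src  : Fin n
    dst  : Fin n
    tdep : ℕ
    tarr : ℕ

open RTuple public

IsRTuple : ∀ {n τ} → TemporalGraph n τ → RTuple n → Set
IsRTuple G r =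
  ∃[ l ] (Journey G (src r) (dst r) (tdep r) l × tarr r ≡ l + TemporalGraph.δ G)

_⊆R_ : ∀ {n} → RTuple n → RTuple n → Set
r₁ ⊆R r₂ = src r₁ ≡ src r₂ × dst r₁ ≡ dst r₂ ×
           tdep r₂ ≤ tdep r₁ × tdep r₁ ≤ tarr r₁ × tarr r₁ ≤ tarr r₂

-- A finite set S of R-tuples of G (a duplicate-free list; its size is its
-- length) that is irredundant: no r ∈ S has another r' ∈ S with r' ⊆ r.
IrredundantRSet : ∀ {n τ} → TemporalGraph n τ → List (RTuple n) → Set
IrredundantRSet {n} G S =
  Unique S × All (IsRTuple G) S ×
  (∀ {r r' : RTuple n} → r ∈ S → r' ∈ S → r' ≢ r → ¬ (r' ⊆R r))

{-# OPTIONS --safe #-}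
module Submission where

-- In an irredundant set an R-tuple is determined by its slot (source,
-- destination, departure): two R-tuples with the same slot have comparable
-- arrivals, so one contains the other and irredundancy makes them equal.
-- Hence an irredundant set injects into the n · n · τ slots.  Conversely, in
-- the complete temporal graph with latency 0 every slot (u, v, t) carries the
-- one-contact R-tuple (u, v, t, t), and these are pairwise ⊆R-incomparable.

open import Defs
open import Data.Nat using (ℕ; suc; _≤_; z≤n; _+_; _*_; s≤s)
open import Data.Nat.Properties
  using (_≟_; ≤-refl; ≤-trans; ≤-reflexive; ≤-antisym; ≤-total; module ≤-Reasoning
        ; m≤m+n; m≤n*m; <⇒≢; *-assoc; *-identityˡ; +-identityʳ)
open import Data.Fin using (Fin)
open import Data.List using (List; []; _∷_; _++_; length; map; cartesianProduct; applyUpTo; allFin)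
open import Data.List.Properties
  using (length-map; length-++; length-applyUpTo; length-tabulate; length-removeAt′)
open import Data.List.Membership.Propositional using (_∈_; _─_)
open import Data.List.Membership.Propositional.Properties
  using (∈-map⁻; ∈-allFin; ∈-applyUpTo⁺; ∈-applyUpTo⁻; ∈-cartesianProduct⁺; ∈-cartesianProduct⁻)
open import Data.List.Relation.Binary.Subset.Propositional using (_⊆_)
open import Data.List.Relation.Unary.Any using (here; there; index)
open import Data.List.Relation.Unary.All as All using ()
open import Data.List.Relation.Unary.All.Properties using (map⁺)
open import Data.List.Relation.Unary.Unique.Propositional using (Unique; []; _∷_)
import Data.List.Relation.Unary.Unique.Propositional.Properties as Unique
open import Data.Product using (_×_; _,_; proj₂; ∃-syntax)
open import Data.Sum using (inj₁; inj₂)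
open import Data.Bool using (true)
open import Relation.Binary.PropositionalEquality
open import Relation.Nullary using (¬_; yes; no; contradiction)
open import Function using (_∘_)

private
  variable
    A B : Set

∈-─⁺ : ∀ {x y : A} {ys : List A} (x∈ys : x ∈ ys) → y ≢ x → y ∈ ys → y ∈ ys ─ x∈ys
∈-─⁺ (here refl) y≢x (here refl) = contradiction refl y≢x
∈-─⁺ (here refl) y≢x (there y∈ys) = y∈ys
∈-─⁺ (there x∈ys) y≢x (here refl) = here refl
∈-─⁺ (there x∈ys) y≢x (there y∈ys) = there (∈-─⁺ x∈ys y≢x y∈ys)

Unique-⊆⇒length≤ : ∀ {xs ys : List A} → Unique xs → xs ⊆ ys → length xs ≤ length ys
Unique-⊆⇒length≤ {xs = []} _ _ = z≤n
Unique-⊆⇒length≤ {xs = x ∷ xs} {ys} (x∉xs ∷ xs!) xs⊆ys =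
  subst (suc (length xs) ≤_) (sym (length-removeAt′ ys (index x∈ys)))
    (s≤s (Unique-⊆⇒length≤ xs! xs⊆ys─x))
  where
  x∈ys = xs⊆ys (here refl)
  xs⊆ys─x : xs ⊆ ys ─ x∈ys
  xs⊆ys─x y∈xs = ∈-─⁺ x∈ys (λ y≡x → All.lookup x∉xs y∈xs (sym y≡x)) (xs⊆ys (there y∈xs))

InjectiveOn : (A → B) → List A → Set
InjectiveOn f xs = ∀ {x y} → x ∈ xs → y ∈ xs → f x ≡ f y → x ≡ y

InjectiveOn⇒Unique-map : ∀ {f : A → B} {xs} → InjectiveOn f xs → Unique xs → Unique (map f xs)
InjectiveOn⇒Unique-map f-inj [] = []
InjectiveOn⇒Unique-map {f = f} f-inj (x∉xs ∷ xs!) =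
  map⁺ (All.tabulate λ y∈xs fx≡fy → All.lookup x∉xs y∈xs (f-inj (here refl) (there y∈xs) fx≡fy))
  ∷ InjectiveOn⇒Unique-map (λ x∈ y∈ → f-inj (there x∈) (there y∈)) xs!

length-cartesianProduct : (xs : List A) (ys : List B) →
                          length (cartesianProduct xs ys) ≡ length xs * length ys
length-cartesianProduct [] ys = refl
length-cartesianProduct (x ∷ xs) ys = begin
  length (map (x ,_) ys ++ cartesianProduct xs ys)
    ≡⟨ length-++ (map (x ,_) ys) ⟩
  length (map (x ,_) ys) + length (cartesianProduct xs ys)
    ≡⟨ cong₂ _+_ (length-map (x ,_) ys) (length-cartesianProduct xs ys) ⟩
  length ys + length xs * length ys
    ∎
  where open ≡-Reasoning

lifetime : ℕ → List ℕ
lifetime τ = applyUpTo suc τ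

∈-lifetime⁺ : ∀ {τ t} → 1 ≤ t → t ≤ τ → t ∈ lifetime τ
∈-lifetime⁺ {t = suc _} _ t≤τ = ∈-applyUpTo⁺ suc t≤τ

∈-lifetime⁻ : ∀ {τ t} → t ∈ lifetime τ → 1 ≤ t × t ≤ τ
∈-lifetime⁻ t∈ with _ , i<τ , refl ← ∈-applyUpTo⁻ suc t∈ = s≤s z≤n , i<τ

Unique-lifetime : ∀ τ → Unique (lifetime τ)
Unique-lifetime τ = Unique.applyUpTo⁺₁ suc τ (λ i<j _ → <⇒≢ (s≤s i<j))

Slot : ℕ → Set
Slot n = Fin n × Fin n × ℕ

slots : (n τ : ℕ) → List (Slot n)
slots n τ = cartesianProduct (allFin n) (cartesianProduct (allFin n) (lifetime τ))

∈-slots⁺ : ∀ {n τ} (u v : Fin n) {t} → 1 ≤ t → t ≤ τ → (u , v , t) ∈ slots n τ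
∈-slots⁺ u v 1≤t t≤τ =
  ∈-cartesianProduct⁺ (∈-allFin u) (∈-cartesianProduct⁺ (∈-allFin v) (∈-lifetime⁺ 1≤t t≤τ))

∈-slots⁻ : ∀ {n τ} {u v : Fin n} {t} → (u , v , t) ∈ slots n τ → 1 ≤ t × t ≤ τ
∈-slots⁻ {n} s∈ =
  ∈-lifetime⁻ (proj₂ (∈-cartesianProduct⁻ (allFin n) _ (proj₂ (∈-cartesianProduct⁻ (allFin n) _ s∈))))

Unique-slots : ∀ n τ → Unique (slots n τ)
Unique-slots n τ = Unique.cartesianProduct⁺ (Unique.allFin⁺ n)
  (Unique.cartesianProduct⁺ (Unique.allFin⁺ n) (Unique-lifetime τ))

length-slots : ∀ n τ → length (slots n τ) ≡ n * n * τ
length-slots n τ = begin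
  length (slots n τ)
    ≡⟨ length-cartesianProduct (allFin n) _ ⟩
  length (allFin n) * length (cartesianProduct (allFin n) (lifetime τ))
    ≡⟨ cong (length (allFin n) *_) (length-cartesianProduct (allFin n) (lifetime τ)) ⟩
  length (allFin n) * (length (allFin n) * length (lifetime τ))
    ≡⟨ cong₂ (λ a b → a * (a * b)) (length-tabulate {n = n} (λ i → i)) (length-applyUpTo suc τ) ⟩
  n * (n * τ)
    ≡⟨ *-assoc n n τ ⟨
  n * n * τ
    ∎
  where open ≡-Reasoning

slot : ∀ {n} → RTuple n → Slot n
slot r = src r , dst r , tdep r

module _ {n τ : ℕ} (G : TemporalGraph n τ) where
  open TemporalGraph G

  departure-inLifetime : ∀ {u v d l} → Journey G u v d l → 1 ≤ d × d ≤ τ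
  departure-inLifetime (single c) = Contact.inLife₁ c , Contact.inLifeτ c
  departure-inLifetime (extend j _ _) = departure-inLifetime j

  departure≤last : ∀ {u v d l} → Journey G u v d l → d ≤ l
  departure≤last (single _) = ≤-refl
  departure≤last (extend {t = t} j _ t+δ≤t') = ≤-trans (departure≤last j) (≤-trans (m≤m+n t δ) t+δ≤t')

  tdep≤tarr : ∀ {r} → IsRTuple G r → tdep r ≤ tarr r
  tdep≤tarr {r} (l , j , refl) = ≤-trans (departure≤last j) (m≤m+n l δ)

  slot∈slots : ∀ {r} → IsRTuple G r → slot r ∈ slots n τ
  slot∈slots {r} (_ , j , _) with 1≤d , d≤τ ← departure-inLifetime j = ∈-slots⁺ (src r) (dst r) 1≤d d≤τ

  same-slot⇒⊆R : ∀ {u v t a b} → IsRTuple G (rtuple u v t a) → a ≤ b →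
                 rtuple u v t a ⊆R rtuple u v t b
  same-slot⇒⊆R isR a≤b = refl , refl , ≤-refl , tdep≤tarr isR , a≤b

  irredundant⇒slot-injectiveOn : ∀ {S} → IrredundantRSet G S → InjectiveOn slot S
  irredundant⇒slot-injectiveOn (_ , S-rtuples , irredundant)
    {rtuple u v t a} {rtuple .u .v .t b} a∈S b∈S refl with a ≟ b
  ... | yes refl = refl
  ... | no a≢b with ≤-total a b
  ...   | inj₁ a≤b = contradiction (same-slot⇒⊆R (All.lookup S-rtuples a∈S) a≤b)
                                   (irredundant b∈S a∈S (a≢b ∘ cong tarr))
  ...   | inj₂ b≤a = contradiction (same-slot⇒⊆R (All.lookup S-rtuples b∈S) b≤a)
                                   (irredundant a∈S b∈S (a≢b ∘ sym ∘ cong tarr))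

  irredundant⇒length≤ : ∀ {S} → IrredundantRSet G S → length S ≤ n * n * τ
  irredundant⇒length≤ {S} S-irr@(S! , S-rtuples , _) = begin
    length S            ≡⟨ length-map slot S ⟨
    length (map slot S) ≤⟨ Unique-⊆⇒length≤ slots-unique slots⊇ ⟩
    length (slots n τ)  ≡⟨ length-slots n τ ⟩
    n * n * τ           ∎
    where
    open ≤-Reasoning
    slots-unique : Unique (map slot S)
    slots-unique = InjectiveOn⇒Unique-map (irredundant⇒slot-injectiveOn S-irr) S!
    slots⊇ : map slot S ⊆ slots n τ
    slots⊇ s∈ with r , r∈S , refl ← ∈-map⁻ slot s∈ = slot∈slots (All.lookup S-rtuples r∈S)

complete : (n τ : ℕ) → TemporalGraph n τ
complete n τ = record { arc = λ _ _ → true ; present = λ _ _ _ → true ; δ = 0 }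

instant : ∀ {n} → Slot n → RTuple n
instant (u , v , t) = rtuple u v t t

instant-injective : ∀ {n} {s s' : Slot n} → instant s ≡ instant s' → s ≡ s'
instant-injective {s = _ , _ , _} {s' = _ , _ , _} refl = refl

instant-isRTuple : ∀ {n τ} {s : Slot n} → s ∈ slots n τ → IsRTuple (complete n τ) (instant s)
instant-isRTuple {s = u , v , t} s∈ with 1≤t , t≤τ ← ∈-slots⁻ s∈ =
  t , single (contact refl 1≤t t≤τ refl) , sym (+-identityʳ t)

instant-⊆R⇒≡ : ∀ {n} (s s' : Slot n) → instant s' ⊆R instant s → instant s' ≡ instant s
instant-⊆R⇒≡ (u , v , t) (.u , .v , t') (refl , refl , t≤t' , _ , t'≤t) =
  cong (λ t → rtuple u v t t) (≤-antisym t'≤t t≤t')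

instants : (n τ : ℕ) → List (RTuple n)
instants n τ = map instant (slots n τ)

irredundant-instants : ∀ n τ → IrredundantRSet (complete n τ) (instants n τ)
irredundant-instants n τ =
  Unique.map⁺ instant-injective (Unique-slots n τ) ,
  All.tabulate isRTuple ,
  incomparable
  where
  isRTuple : ∀ {r} → r ∈ instants n τ → IsRTuple (complete n τ) r
  isRTuple r∈ with s , s∈ , refl ← ∈-map⁻ instant r∈ = instant-isRTuple s∈
  incomparable : ∀ {r r'} → r ∈ instants n τ → r' ∈ instants n τ → r' ≢ r → ¬ (r' ⊆R r)
  incomparable r∈ r'∈ r'≢r r'⊆r
    with s , _ , refl ← ∈-map⁻ instant r∈ | s' , _ , refl ← ∈-map⁻ instant r'∈ =
    r'≢r (instant-⊆R⇒≡ s s' r'⊆r)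

length-instants : ∀ n τ → length (instants n τ) ≡ n * n * τ
length-instants n τ = trans (length-map instant (slots n τ)) (length-slots n τ)

lemma2 : (∃[ C ] (∀ (n τ : ℕ) (G : TemporalGraph n τ) (S : List (RTuple n)) →
           IrredundantRSet G S → length S ≤ C * (n * n * τ)))
         ×
         (∃[ c ] ∃[ N ] (∀ (n τ : ℕ) → N ≤ n → N ≤ τ →
           ∃[ G ] ∃[ S ] (IrredundantRSet {n} {τ} G S × n * n * τ ≤ c * length S)))
lemma2 = (1 , upper) , (1 , 0 , lower)
  where
  upper : ∀ n τ (G : TemporalGraph n τ) S → IrredundantRSet G S → length S ≤ 1 * (n * n * τ)
  upper n τ G S S-irr = ≤-trans (irredundant⇒length≤ G S-irr) (m≤n*m (n * n * τ) 1)
  lower : ∀ n τ → 0 ≤ n → 0 ≤ τ →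
          ∃[ G ] ∃[ S ] (IrredundantRSet {n} {τ} G S × n * n * τ ≤ 1 * length S)
  lower n τ _ _ = complete n τ , instants n τ , irredundant-instants n τ ,
    ≤-reflexive (trans (sym (length-instants n τ)) (sym (*-identityˡ _)))
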